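{- Let $P$ be an oriented hitomezashi path. Let $s,t,t',s'$ be horizontal stitches that appear in this order as we traverse $P$ (up to a cyclic shift if $P$ is a loop), and assume $\mathrm{lat}(s)=\mathrm{lat}(s')$ and $\mathrm{lat}(t)=\mathrm{lat}(t')$. Suppose that all vertical stitches in $P_{[s,t]}$ are oriented from south to north and all vertical stitches in $P_{[t',s']}$ are oriented from north to south. Then $P_{[t',s']}$ can be obtained by reflecting $P_{[s,t]}$ across a vertical line (ignoring orientations). The analogous statement, with the roles of horizontal and vertical exchanged and with reflection across a horizontal line, also holds.
   Context: A hitomezashi pattern is determined by labels $\epsilon_i\in\{0,1\}$ for every integer $i$ and $\eta_j\in\{0,1\}$ for every integer $j$. Its vertical stitches are the unit segments from $(i,j)$ to $(i,j+1)$ for all integers $i,j$ with $j\equiv \epsilon_i \pmod 2$; its horizontal stitches are the unit segments from $(i,j)$ to $(i+1,j)$ for all integers $i,j$ with $i\equiv \eta_j\pmod 2$. A hitomezashi path is an embedded curve formed by a union of stitches of a hitomezashi pattern (a hitomezashi loop is a closed one); it is oriented by choosing a direction of traversal. The latitude $\mathrm{lat}(s)$ of a unit segment $s$ is the $y$-coordinate of its midpoint. If a stitch $s$ appears before a stitch $t$ when traversing an oriented path $P$, then $P_{[s,t]}$ denotes the subpath of $P$ from $s$ to $t$, including $s$ and $t$. -}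

module Defs where

open import Data.Nat as ℕ using (ℕ; suc; _≤_; _<_)
open import Data.Integer as ℤ using (ℤ; +_; _+_; _-_)
open import Data.Integer.Divisibility using (_∣_)
open import Data.Fin using (Fin; toℕ)
open import Data.Product using (_×_; _,_; proj₁; proj₂; ∃)
open import Data.Sum using (_⊎_)
open import Relation.Binary.PropositionalEquality using (_≡_)

Point : Set
Point = ℤ × ℤ

xc yc : Point → ℤ
xc = proj₁
yc = proj₂

record Pattern : Set where
  field
    ε : ℤ → Fin 2
    η : ℤ → Fin 2
open Pattern public

_≡₂_ : ℤ → ℤ → Set
a ≡₂ b = + 2 ∣ (a - b)

-- the unit segment (i,j)—(i,j+1) is a (vertical) stitch iff j ≡ ε_i (mod 2)
VStitch : Pattern → ℤ → ℤ → Set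
VStitch P i j = j ≡₂ (+ toℕ (ε P i))

-- the unit segment (i,j)—(i+1,j) is a (horizontal) stitch iff i ≡ η_j (mod 2)
HStitch : Pattern → ℤ → ℤ → Set
HStitch P i j = i ≡₂ (+ toℕ (η P j))

IsNorth IsSouth IsEast IsWest : Point → Point → Set
IsNorth p q = xc q ≡ xc p × yc q ≡ yc p + + 1
IsSouth p q = IsNorth q p
IsEast  p q = xc q ≡ xc p + + 1 × yc q ≡ yc p
IsWest  p q = IsEast q p

Vertical Horizontal : Point → Point → Set
Vertical   p q = IsNorth p q ⊎ IsSouth p q
Horizontal p q = IsEast p q ⊎ IsWest p q

Stitch : Pattern → Point → Point → Set
Stitch P p q =
  (IsNorth p q × VStitch P (xc p) (yc p)) ⊎
  (IsSouth p q × VStitch P (xc q) (yc q)) ⊎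
  (IsEast  p q × HStitch P (xc p) (yc p)) ⊎
  (IsWest  p q × HStitch P (xc q) (yc q))

-- A finite oriented hitomezashi path (open, or closed = a loop), given by
-- its vertices vtx 0, vtx 1, …, vtx len (values beyond len are irrelevant).
record HPath (P : Pattern) : Set where
  field
    len      : ℕ
    vtx      : ℕ → Point
    steps    : ∀ k → k < len → Stitch P (vtx k) (vtx (suc k))
    embedded : ∀ i j → i < j → j ≤ len → vtx i ≡ vtx j →
               i ≡ 0 × j ≡ len × 3 ≤ len
open HPath public

-- twice the latitude (y-coordinate of the midpoint) of the segment p—q
lat2 : Point → Point → ℤ
lat2 p q = yc p + yc q

-- twice the x-coordinate of the midpoint of the segment p—q
lon2 : Point → Point → ℤ
lon2 p q = xc p + xc q

SameSeg : Point → Point → Point → Point → Set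
SameSeg p q p' q' = (p ≡ p' × q ≡ q') ⊎ (p ≡ q' × q ≡ p')

-- reflection across the vertical line x = m/2, and the horizontal line y = m/2
reflV reflH : ℤ → Point → Point
reflV m (x , y) = (m - x , y)
reflH m (x , y) = (x , m - y)

ReflectedSubpath : ∀ {P} → (Point → Point) → HPath P → ℕ → ℕ → ℕ → ℕ → Set
ReflectedSubpath ρ Q a b c d =
  (∀ k → c ≤ k → k ≤ d → ∃ λ k' → a ≤ k' × k' ≤ b ×
     SameSeg (vtx Q k) (vtx Q (suc k)) (ρ (vtx Q k')) (ρ (vtx Q (suc k')))) ×
  (∀ k' → a ≤ k' → k' ≤ b → ∃ λ k → c ≤ k × k ≤ d ×
     SameSeg (vtx Q k) (vtx Q (suc k)) (ρ (vtx Q k')) (ρ (vtx Q (suc k'))))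

{-# OPTIONS --safe #-}

-- Pair the stitches of P_[s,t] with those of P_[t′,s′] from the outside in: the i-th
-- stitch after s with the i-th stitch before s′.  Stitch kinds alternate along a
-- hitomezashi path and x + y changes parity at every step, so s and s′, lying in one
-- row, produce an odd m: the line x = m/2 passes through midpoints of horizontal unit
-- segments, and reflection in it maps the stitches of each row to stitches.  Hence if
-- a stitch of P_[t′,s′] ends at the mirror image of the start of its partner, it
-- starts at the mirror image of the partner's end (vertical partners go north and
-- south respectively), and the next pair is mirrored as well.  The pairing reaches t
-- and t′ simultaneously: every horizontal stitch of P_[s,t] before t lies strictly
-- below t, because the stitch after it goes north and latitude never decreases along
-- P_[s,t]; symmetrically along P_[t′,s′].  The vertical statement is the horizontal
-- one for the transposed pattern.

module Submission where

open import Defs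
open import Data.Nat using (ℕ; suc; _≤_; _<_)
open import Data.Integer using (ℤ)
open import Data.Product using (_×_; ∃)
open import Relation.Binary.PropositionalEquality using (_≡_)

open import Data.Nat.Base using (_≤′_; ≤′-reflexive; ≤′-step)
import Data.Nat as ℕ
import Data.Nat.Properties as ℕₚ
open import Data.Nat.Divisibility using (∣1⇒≡1)
open import Data.Integer using (+_; _+_; _-_; _*_; 0ℤ; 1ℤ)
import Data.Integer as ℤ
import Data.Integer.Properties as ℤₚ
open import Data.Integer.Divisibility.Signed using (_∣_; divides; ∣ᵤ⇒∣; ∣⇒∣ᵤ; ∣m∣n⇒∣m+n; ∣m∣n⇒∣m-n)
open import Data.Integer.Tactic.RingSolver using (solve-∀)
open import Data.Product using (_,_; proj₁; proj₂)
open import Data.Sum using (_⊎_; inj₁; inj₂)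
open import Data.Empty using (⊥-elim)
open import Function.Base using (flip)
open import Level using (Level)
open import Relation.Nullary using (¬_)
open import Relation.Binary.Core using (Rel)
open import Relation.Binary.Definitions using (Reflexive; Transitive)
open import Relation.Binary.PropositionalEquality
  using (_≢_; refl; sym; trans; cong; cong₂; subst; module ≡-Reasoning)

private
  variable
    ℓ : Level
    P : Pattern
    p q r p′ q′ : Point
    a b i j k : ℕ

≤-interval-induction : (C : ℕ → Set ℓ) → C a →
                       (∀ {k} → a ≤ k → k < b → C k → C (suc k)) →
                       a ≤ k → k ≤ b → C k
≤-interval-induction {a = a} {b = b} C base step a≤k k≤b = go (ℕₚ.≤⇒≤′ a≤k) k≤b
  where
  go : ∀ {k} → a ≤′ k → k ≤ b → C k
  go (≤′-reflexive refl) _   = base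
  go (≤′-step a≤′k)     k<b = step (ℕₚ.≤′⇒≤ a≤′k) k<b (go a≤′k (ℕₚ.<⇒≤ k<b))

stepwise⇒related : {A : Set ℓ} {_∼_ : Rel A ℓ} → Reflexive _∼_ → Transitive _∼_ →
                   (f : ℕ → A) {i j : ℕ} → (∀ {k} → i ≤ k → k < j → f k ∼ f (suc k)) →
                   i ≤ j → f i ∼ f j
stepwise⇒related {_∼_ = _∼_} refl∼ trans∼ f {i} step i≤j =
  ≤-interval-induction (λ k → f i ∼ f k) refl∼
    (λ i≤k k<j fi∼fk → trans∼ fi∼fk (step i≤k k<j)) i≤j ℕₚ.≤-refl

mirror-index : ∀ {a b c d k} → b ℕ.+ c ≡ a ℕ.+ d → c ≤ k → k ≤ d →
               ∃ λ n → a ≤ n × n ≤ b × n ℕ.+ k ≡ a ℕ.+ d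
mirror-index {a} {b} {c} {d} {k} b+c≡a+d c≤k k≤d = n , a≤n , n≤b , n+k≡a+d
  where
  open ℕₚ.≤-Reasoning
  n : ℕ
  n = (a ℕ.+ d) ℕ.∸ k
  n+k≡a+d : n ℕ.+ k ≡ a ℕ.+ d
  n+k≡a+d = ℕₚ.m∸n+n≡m (ℕₚ.≤-trans k≤d (ℕₚ.m≤n+m d a))
  a≤n : a ≤ n
  a≤n = ℕₚ.+-cancelʳ-≤ k a n (begin
    a ℕ.+ k  ≤⟨ ℕₚ.+-monoʳ-≤ a k≤d ⟩
    a ℕ.+ d  ≡⟨ n+k≡a+d ⟨
    n ℕ.+ k  ∎)
  n≤b : n ≤ b
  n≤b = ℕₚ.+-cancelʳ-≤ k n b (begin
    n ℕ.+ k  ≡⟨ n+k≡a+d ⟩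
    a ℕ.+ d  ≡⟨ b+c≡a+d ⟨
    b ℕ.+ c  ≤⟨ ℕₚ.+-monoʳ-≤ b c≤k ⟩
    b ℕ.+ k  ∎)

Even Odd : ℤ → Set
Even z = + 2 ∣ z
Odd  z = Even (z + 1ℤ)

¬even-1 : ¬ Even 1ℤ
¬even-1 e with ∣1⇒≡1 (∣⇒∣ᵤ e)
... | ()

even-double : ∀ h → Even (h + h)
even-double h = divides h (double≡*2 h)
  where
  double≡*2 : ∀ h → h + h ≡ h * + 2
  double≡*2 = solve-∀

odd⇒¬even : ∀ {z} → Odd z → ¬ Even z
odd⇒¬even {z} o e = ¬even-1 (subst Even (difference z) (∣m∣n⇒∣m-n o e))
  where
  difference : ∀ z → (z + 1ℤ) - z ≡ 1ℤ
  difference = solve-∀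

odd+even : ∀ {u w} → Odd u → Even w → Odd (u + w)
odd+even {u} {w} o e = subst Even (regroup u w) (∣m∣n⇒∣m+n o e)
  where
  regroup : ∀ u w → (u + 1ℤ) + w ≡ (u + w) + 1ℤ
  regroup = solve-∀

odd+odd : ∀ {u w} → Odd u → Odd w → Even (u + w)
odd+odd {u} {w} o o′ =
  subst Even (regroup u w) (∣m∣n⇒∣m+n (∣m∣n⇒∣m+n o o′) (even-double (ℤ.- 1ℤ)))
  where
  regroup : ∀ u w → ((u + 1ℤ) + (w + 1ℤ)) + (ℤ.- 1ℤ + ℤ.- 1ℤ) ≡ u + w
  regroup = solve-∀

≡₂⇒even : ∀ {x y} → x ≡₂ y → Even (x - y)
≡₂⇒even = ∣ᵤ⇒∣

≡₂⇒even-sum : ∀ {x y e} → x ≡₂ e → y ≡₂ e → Even (x + y)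
≡₂⇒even-sum {x} {y} {e} x≡e y≡e =
  subst Even (regroup x y e)
    (∣m∣n⇒∣m+n (∣m∣n⇒∣m+n (≡₂⇒even {x} x≡e) (≡₂⇒even {y} y≡e)) (even-double e))
  where
  regroup : ∀ x y e → ((x - e) + (y - e)) + (e + e) ≡ x + y
  regroup = solve-∀

¬≡₂-suc : ∀ x e → x ≡₂ e → ¬ ((x + 1ℤ) ≡₂ e)
¬≡₂-suc x e x≡e x+1≡e =
  ¬even-1 (subst Even (difference x e) (∣m∣n⇒∣m-n (≡₂⇒even {x + 1ℤ} x+1≡e) (≡₂⇒even {x} x≡e)))
  where
  difference : ∀ x e → ((x + 1ℤ) - e) - (x - e) ≡ 1ℤ
  difference = solve-∀

i≢i+1 : ∀ {i} → i ≢ i + 1ℤ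
i≢i+1 {i} eq = ℤₚ.i≢suc[i] (trans eq (ℤₚ.+-comm i 1ℤ))

+1-injective : ∀ {x y} → x + 1ℤ ≡ y + 1ℤ → x ≡ y
+1-injective {x} {y} eq = begin
  x                ≡⟨ cancel x ⟨
  (x + 1ℤ) - 1ℤ    ≡⟨ cong (_- 1ℤ) eq ⟩
  (y + 1ℤ) - 1ℤ    ≡⟨ cancel y ⟩
  y                ∎
  where
  open ≡-Reasoning
  cancel : ∀ x → (x + 1ℤ) - 1ℤ ≡ x
  cancel = solve-∀

+1≤⇒< : ∀ {x y} → x + 1ℤ ℤ.≤ y → x ℤ.< y
+1≤⇒< {x} x+1≤y = ℤₚ.suc[i]≤j⇒i<j (subst (ℤ._≤ _) (ℤₚ.+-comm x 1ℤ) x+1≤y)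

double-injective : ∀ {x y} → x + x ≡ y + y → x ≡ y
double-injective {x} {y} eq = ℤₚ.*-cancelˡ-≡ (+ 2) x y (trans (double x) (trans eq (sym (double y))))
  where
  double : ∀ x → + 2 * x ≡ x + x
  double = solve-∀

horizontal⇒¬vertical : Horizontal p q → ¬ Vertical p q
horizontal⇒¬vertical (inj₁ (_ , e)) (inj₁ (_ , n)) = i≢i+1 (trans (sym e) n)
horizontal⇒¬vertical (inj₁ (_ , e)) (inj₂ (_ , s)) = i≢i+1 (trans e s)
horizontal⇒¬vertical (inj₂ (_ , w)) (inj₁ (_ , n)) = i≢i+1 (trans w n)
horizontal⇒¬vertical (inj₂ (_ , w)) (inj₂ (_ , s)) = i≢i+1 (trans (sym w) s)

stitch⇒horizontal⊎vertical : Stitch P p q → Horizontal p q ⊎ Vertical p q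
stitch⇒horizontal⊎vertical (inj₁ (n , _))               = inj₂ (inj₁ n)
stitch⇒horizontal⊎vertical (inj₂ (inj₁ (s , _)))        = inj₂ (inj₂ s)
stitch⇒horizontal⊎vertical (inj₂ (inj₂ (inj₁ (e , _)))) = inj₁ (inj₁ e)
stitch⇒horizontal⊎vertical (inj₂ (inj₂ (inj₂ (w , _)))) = inj₁ (inj₂ w)

HorizontalStitch : Pattern → Point → Point → Set
HorizontalStitch P p q =
  (IsEast p q × HStitch P (xc p) (yc p)) ⊎ (IsWest p q × HStitch P (xc q) (yc q))

stitch-horizontal : Stitch P p q → Horizontal p q → HorizontalStitch P p q
stitch-horizontal (inj₁ (n , _))        h = ⊥-elim (horizontal⇒¬vertical h (inj₁ n))
stitch-horizontal (inj₂ (inj₁ (s , _))) h = ⊥-elim (horizontal⇒¬vertical h (inj₂ s))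
stitch-horizontal (inj₂ (inj₂ east⊎west)) _ = east⊎west

horizontal-horizontal⇒backtrack : Stitch P p q → Stitch P q r →
                                  Horizontal p q → Horizontal q r → p ≡ r
horizontal-horizontal⇒backtrack {p = x , y} {r = x″ , y″} s t h h′
  with stitch-horizontal s h | stitch-horizontal t h′
... | inj₁ ((refl , refl) , sx) | inj₁ ((refl , refl) , sx+1) = ⊥-elim (¬≡₂-suc x _ sx sx+1)
... | inj₁ ((refl , refl) , _)  | inj₂ ((x+1≡x″+1 , refl) , _) =
  cong₂ _,_ (+1-injective x+1≡x″+1) refl
... | inj₂ ((refl , refl) , _)  | inj₁ ((x″≡x , refl) , _) =
  cong₂ _,_ (sym x″≡x) refl
... | inj₂ ((refl , refl) , sx″+1) | inj₂ ((refl , refl) , sx″) = ⊥-elim (¬≡₂-suc x″ _ sx″ sx″+1)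

predecessor-of-reflection : ∀ m x {s} → m - x ≡ s + 1ℤ → s ≡ m - (x + 1ℤ)
predecessor-of-reflection m x m-x≡s+1 = +1-injective (trans (sym m-x≡s+1) (shift m x))
  where
  shift : ∀ m x → m - x ≡ (m - (x + 1ℤ)) + 1ℤ
  shift = solve-∀

-- In the mixed east/west cases the two stitches of the row would have left ends
-- summing to m or m − 2, hence of different parities.
reflV-reverses-stitch :
  ∀ {m} → Odd m → Stitch P p p′ → Stitch P q q′ → q′ ≡ reflV m p →
  (Horizontal p p′ × Horizontal q q′) ⊎ (IsNorth p p′ × IsSouth q q′) →
  q ≡ reflV m p′
reflV-reverses-stitch {p = _ , _} {p′ = _ , _} {q = _ , _} _ _ _ refl
  (inj₂ ((refl , refl) , (refl , refl))) = refl
reflV-reverses-stitch {p = x , y} {p′ = x′ , _} {q = s , _} {m = m} odd st st′ refl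
  (inj₁ (h , h′)) with stitch-horizontal st h | stitch-horizontal st′ h′
... | inj₁ ((refl , refl) , _) | inj₁ ((m-x≡s+1 , refl) , _) =
  cong₂ _,_ (predecessor-of-reflection m x m-x≡s+1) refl
... | inj₂ ((refl , refl) , _) | inj₂ ((refl , refl) , _) = cong₂ _,_ (shift m x′) refl
  where
  shift : ∀ m x → (m - (x + 1ℤ)) + 1ℤ ≡ m - x
  shift = solve-∀
... | inj₁ (_ , sx) | inj₂ (_ , sm-x) =
  ⊥-elim (odd⇒¬even {m} odd (subst Even (cancel m x) (≡₂⇒even-sum {x} {m - x} sx sm-x)))
  where
  cancel : ∀ m x → x + (m - x) ≡ m
  cancel = solve-∀
... | inj₂ ((refl , refl) , sx′) | inj₁ ((m-x≡s+1 , refl) , ss) =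
  ⊥-elim (odd⇒¬even {m} odd (subst Even sum≡m
    (∣m∣n⇒∣m+n (≡₂⇒even-sum {x′} {s} sx′ ss) (even-double 1ℤ))))
  where
  cancel : ∀ m x → (x + (m - ((x + 1ℤ) + 1ℤ))) + (1ℤ + 1ℤ) ≡ m
  cancel = solve-∀
  sum≡m : (x′ + s) + (1ℤ + 1ℤ) ≡ m
  sum≡m = trans (cong (λ s → (x′ + s) + (1ℤ + 1ℤ))
                      (predecessor-of-reflection m (x′ + 1ℤ) m-x≡s+1))
                (cancel m x′)

transpose : Point → Point
transpose (x , y) = y , x

transposePattern : Pattern → Pattern
transposePattern P = record { ε = η P ; η = ε P }

stitch-transpose : Stitch P p q → Stitch (transposePattern P) (transpose p) (transpose q)
stitch-transpose (inj₁ ((ex , ey) , s))               = inj₂ (inj₂ (inj₁ ((ey , ex) , s)))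
stitch-transpose (inj₂ (inj₁ ((ex , ey) , s)))        = inj₂ (inj₂ (inj₂ ((ey , ex) , s)))
stitch-transpose (inj₂ (inj₂ (inj₁ ((ex , ey) , s)))) = inj₁ ((ey , ex) , s)
stitch-transpose (inj₂ (inj₂ (inj₂ ((ex , ey) , s)))) = inj₂ (inj₁ ((ey , ex) , s))

vertical⇒horizontalᵀ : Vertical p q → Horizontal (transpose p) (transpose q)
vertical⇒horizontalᵀ (inj₁ (ex , ey)) = inj₁ (ey , ex)
vertical⇒horizontalᵀ (inj₂ (ex , ey)) = inj₂ (ey , ex)

transposePath : HPath P → HPath (transposePattern P)
transposePath {P} Q = record
  { len      = len Q
  ; vtx      = λ k → transpose (vtx Q k)
  ; steps    = λ k k<len → stitch-transpose {P = P} (steps Q k k<len)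
  ; embedded = λ i j i<j j≤len eq → embedded Q i j i<j j≤len (cong transpose eq)
  }

verticalᵀ⇒horizontal : Vertical (transpose p) (transpose q) → Horizontal p q
verticalᵀ⇒horizontal (inj₁ (ex , ey)) = inj₁ (ey , ex)
verticalᵀ⇒horizontal (inj₂ (ex , ey)) = inj₂ (ey , ex)

east⇒northᵀ : IsEast p q → IsNorth (transpose p) (transpose q)
east⇒northᵀ (ex , ey) = ey , ex

sameSeg-transpose : SameSeg (transpose p) (transpose q) (transpose p′) (transpose q′) →
                    SameSeg p q p′ q′
sameSeg-transpose (inj₁ (e , e′)) = inj₁ (cong transpose e , cong transpose e′)
sameSeg-transpose (inj₂ (e , e′)) = inj₂ (cong transpose e , cong transpose e′)

vertical-vertical⇒backtrack : Stitch P p q → Stitch P q r →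
                              Vertical p q → Vertical q r → p ≡ r
vertical-vertical⇒backtrack s t v v′ = cong transpose
  (horizontal-horizontal⇒backtrack (stitch-transpose s) (stitch-transpose t)
    (vertical⇒horizontalᵀ v) (vertical⇒horizontalᵀ v′))

horizontal⇒same-row : Horizontal p q → yc q ≡ yc p
horizontal⇒same-row (inj₁ (_ , e)) = e
horizontal⇒same-row (inj₂ (_ , w)) = sym w

same-latitude⇒same-row : Horizontal p q → Horizontal p′ q′ → lat2 p q ≡ lat2 p′ q′ → yc p ≡ yc p′
same-latitude⇒same-row {p} {q} {p′} {q′} h h′ eq = double-injective (begin
  yc p + yc p    ≡⟨ cong (λ y → yc p + y) (sym (horizontal⇒same-row h)) ⟩
  lat2 p q       ≡⟨ eq ⟩
  lat2 p′ q′     ≡⟨ cong (λ y → yc p′ + y) (horizontal⇒same-row h′) ⟩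
  yc p′ + yc p′  ∎)
  where open ≡-Reasoning

coordSum : Point → ℤ
coordSum p = xc p + yc p

stitch⇒odd-coordSum-step : Stitch P p q → Odd (coordSum q - coordSum p)
stitch⇒odd-coordSum-step {p = x , y} (inj₁ ((refl , refl) , _)) =
  subst Even (up x y) (even-double 1ℤ)
  where
  up : ∀ x y → 1ℤ + 1ℤ ≡ ((x + (y + 1ℤ)) - (x + y)) + 1ℤ
  up = solve-∀
stitch⇒odd-coordSum-step {q = x , y} (inj₂ (inj₁ ((refl , refl) , _))) =
  subst Even (down x y) (even-double 0ℤ)
  where
  down : ∀ x y → 0ℤ + 0ℤ ≡ ((x + y) - (x + (y + 1ℤ))) + 1ℤ
  down = solve-∀
stitch⇒odd-coordSum-step {p = x , y} (inj₂ (inj₂ (inj₁ ((refl , refl) , _)))) =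
  subst Even (right x y) (even-double 1ℤ)
  where
  right : ∀ x y → 1ℤ + 1ℤ ≡ (((x + 1ℤ) + y) - (x + y)) + 1ℤ
  right = solve-∀
stitch⇒odd-coordSum-step {q = x , y} (inj₂ (inj₂ (inj₂ ((refl , refl) , _)))) =
  subst Even (left x y) (even-double 0ℤ)
  where
  left : ∀ x y → 0ℤ + 0ℤ ≡ ((x + y) - ((x + 1ℤ) + y)) + 1ℤ
  left = solve-∀

module PathProperties {P : Pattern} (Q : HPath P) where

  X Y : ℕ → ℤ
  X k = xc (vtx Q k)
  Y k = yc (vtx Q k)

  HorizontalAt VerticalAt : ℕ → Set
  HorizontalAt k = Horizontal (vtx Q k) (vtx Q (suc k))
  VerticalAt   k = Vertical   (vtx Q k) (vtx Q (suc k))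

  SameKind : ℕ → ℕ → Set
  SameKind i j = (HorizontalAt i × HorizontalAt j) ⊎ (VerticalAt i × VerticalAt j)

  kind : k < len Q → HorizontalAt k ⊎ VerticalAt k
  kind {k} k<len = stitch⇒horizontal⊎vertical {P = P} (steps Q k k<len)

  no-backtrack : suc k < len Q → vtx Q k ≢ vtx Q (suc (suc k))
  no-backtrack {k} k+1<len eq
    with embedded Q k (suc (suc k)) (ℕₚ.<-trans (ℕₚ.n<1+n k) (ℕₚ.n<1+n (suc k))) k+1<len eq
  ... | refl , 2≡len , 3≤len = ℕₚ.<-irrefl 2≡len 3≤len

  ¬horizontal-horizontal : suc k < len Q → HorizontalAt k → ¬ HorizontalAt (suc k)
  ¬horizontal-horizontal {k} k+1<len h h′ = no-backtrack k+1<len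
    (horizontal-horizontal⇒backtrack {P = P} (steps Q k (ℕₚ.<⇒≤ k+1<len)) (steps Q (suc k) k+1<len) h h′)

  ¬vertical-vertical : suc k < len Q → VerticalAt k → ¬ VerticalAt (suc k)
  ¬vertical-vertical {k} k+1<len v v′ = no-backtrack k+1<len
    (vertical-vertical⇒backtrack {P = P} (steps Q k (ℕₚ.<⇒≤ k+1<len)) (steps Q (suc k) k+1<len) v v′)

  horizontal⇒next-vertical : suc k < len Q → HorizontalAt k → VerticalAt (suc k)
  horizontal⇒next-vertical k+1<len h with kind k+1<len
  ... | inj₁ h′ = ⊥-elim (¬horizontal-horizontal k+1<len h h′)
  ... | inj₂ v  = v

  vertical⇒next-horizontal : suc k < len Q → VerticalAt k → HorizontalAt (suc k)
  vertical⇒next-horizontal k+1<len v with kind k+1<len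
  ... | inj₁ h  = h
  ... | inj₂ v′ = ⊥-elim (¬vertical-vertical k+1<len v v′)

  next-horizontal⇒vertical : suc k < len Q → HorizontalAt (suc k) → VerticalAt k
  next-horizontal⇒vertical k+1<len h′ with kind (ℕₚ.<⇒≤ k+1<len)
  ... | inj₁ h = ⊥-elim (¬horizontal-horizontal k+1<len h h′)
  ... | inj₂ v = v

  next-vertical⇒horizontal : suc k < len Q → VerticalAt (suc k) → HorizontalAt k
  next-vertical⇒horizontal k+1<len v′ with kind (ℕₚ.<⇒≤ k+1<len)
  ... | inj₁ h = h
  ... | inj₂ v = ⊥-elim (¬vertical-vertical k+1<len v v′)

  sameKind-step : suc i < len Q → suc j < len Q → SameKind i (suc j) → SameKind (suc i) j
  sameKind-step i+1<len j+1<len (inj₁ (h , h′)) =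
    inj₂ (horizontal⇒next-vertical i+1<len h , next-horizontal⇒vertical j+1<len h′)
  sameKind-step i+1<len j+1<len (inj₂ (v , v′)) =
    inj₁ (vertical⇒next-horizontal i+1<len v , next-vertical⇒horizontal j+1<len v′)

  Δ : ℕ → ℕ → ℤ
  Δ i k = coordSum (vtx Q k) - coordSum (vtx Q i)

  Δ-trans : ∀ i j k → Δ j k + Δ i j ≡ Δ i k
  Δ-trans i j k = split (coordSum (vtx Q i)) (coordSum (vtx Q j)) (coordSum (vtx Q k))
    where
    split : ∀ x y z → (z - y) + (y - x) ≡ z - x
    split = solve-∀

  odd-Δ-step : k < len Q → Odd (Δ k (suc k))
  odd-Δ-step {k} k<len = stitch⇒odd-coordSum-step {P = P} (steps Q k k<len)

  horizontal⇒parity-alternates :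
    HorizontalAt a → a ≤ k → k < len Q →
    (HorizontalAt k × Even (Δ a k)) ⊎ (VerticalAt k × Odd (Δ a k))
  horizontal⇒parity-alternates {a} {k} ha a≤k k<len =
    ≤-interval-induction C base step a≤k ℕₚ.≤-refl
    where
    C : ℕ → Set
    C j = (HorizontalAt j × Even (Δ a j)) ⊎ (VerticalAt j × Odd (Δ a j))

    x-x≡0 : ∀ x → 0ℤ + 0ℤ ≡ x - x
    x-x≡0 = solve-∀

    base : C a
    base = inj₁ (ha , subst Even (x-x≡0 (coordSum (vtx Q a))) (even-double 0ℤ))

    step : ∀ {j} → a ≤ j → j < k → C j → C (suc j)
    step {j} _ j<k = advance
      where
      j+1<len : suc j < len Q
      j+1<len = ℕₚ.≤-<-trans j<k k<len

      odd-step : Odd (Δ j (suc j))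
      odd-step = odd-Δ-step (ℕₚ.<⇒≤ j+1<len)

      advance : C j → C (suc j)
      advance (inj₁ (h , e)) =
        inj₂ (horizontal⇒next-vertical j+1<len h ,
              subst Odd (Δ-trans a j (suc j)) (odd+even {Δ j (suc j)} odd-step e))
      advance (inj₂ (v , o)) =
        inj₁ (vertical⇒next-horizontal j+1<len v ,
              subst Even (Δ-trans a j (suc j)) (odd+odd {Δ j (suc j)} odd-step o))

  odd-mirror-axis : a ≤ k → k < len Q → HorizontalAt a → HorizontalAt k →
                    Y a ≡ Y k → Odd (X a + X (suc k))
  odd-mirror-axis {a} {k} a≤k k<len ha hk Ya≡Yk with horizontal⇒parity-alternates ha a≤k k<len
  ... | inj₂ (vk , _)  = ⊥-elim (horizontal⇒¬vertical hk vk)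
  ... | inj₁ (_ , even) = subst Odd regrouped (odd+even {Δ a (suc k)} odd-Δ (even-double (X a)))
    where
    odd-Δ : Odd (Δ a (suc k))
    odd-Δ = subst Odd (Δ-trans a k (suc k)) (odd+even {Δ k (suc k)} (odd-Δ-step k<len) even)

    Yk+1≡Ya : Y (suc k) ≡ Y a
    Yk+1≡Ya = trans (horizontal⇒same-row hk) (sym Ya≡Yk)

    regroup : ∀ x x′ y → ((x′ + y) - (x + y)) + (x + x) ≡ x + x′
    regroup = solve-∀

    regrouped : Δ a (suc k) + (X a + X a) ≡ X a + X (suc k)
    regrouped = begin
      ((X (suc k) + Y (suc k)) - (X a + Y a)) + (X a + X a)
        ≡⟨ cong (λ y → ((X (suc k) + y) - (X a + Y a)) + (X a + X a)) Yk+1≡Ya ⟩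
      ((X (suc k) + Y a) - (X a + Y a)) + (X a + X a)
        ≡⟨ regroup (X a) (X (suc k)) (Y a) ⟩
      X a + X (suc k) ∎
      where open ≡-Reasoning

module MirrorAcrossVerticalLine {P : Pattern} (Q : HPath P) {a b c d : ℕ}
  (a≤b : a ≤ b) (b≤c : b ≤ c) (c≤d : c ≤ d) (d<len : d < len Q)
  (ha : PathProperties.HorizontalAt Q a) (hb : PathProperties.HorizontalAt Q b)
  (hc : PathProperties.HorizontalAt Q c) (hd : PathProperties.HorizontalAt Q d)
  (Ya≡Yd : PathProperties.Y Q a ≡ PathProperties.Y Q d)
  (Yb≡Yc : PathProperties.Y Q b ≡ PathProperties.Y Q c)
  (north : ∀ k → a ≤ k → k ≤ b → Vertical (vtx Q k) (vtx Q (suc k)) → IsNorth (vtx Q k) (vtx Q (suc k)))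
  (south : ∀ k → c ≤ k → k ≤ d → Vertical (vtx Q k) (vtx Q (suc k)) → IsSouth (vtx Q k) (vtx Q (suc k)))
  where

  open PathProperties Q

  private
    c<len : c < len Q
    c<len = ℕₚ.≤-<-trans c≤d d<len

    b<len : b < len Q
    b<len = ℕₚ.≤-<-trans b≤c c<len

  axis : ℤ
  axis = X a + X (suc d)

  odd-axis : Odd axis
  odd-axis = odd-mirror-axis (ℕₚ.≤-trans a≤b (ℕₚ.≤-trans b≤c c≤d)) d<len ha hd Ya≡Yd

  Mirrored : ℕ → ℕ → Set
  Mirrored i j = vtx Q (suc j) ≡ reflV axis (vtx Q i) × SameKind i j

  mirrored-ends : Mirrored a d
  mirrored-ends =
    cong₂ _,_ (x′≡[x+x′]-x (X a) (X (suc d))) (trans (horizontal⇒same-row hd) (sym Ya≡Yd)) ,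
    inj₁ (ha , hd)
    where
    x′≡[x+x′]-x : ∀ x x′ → x′ ≡ (x + x′) - x
    x′≡[x+x′]-x = solve-∀

  mirrored⇒mirrored-start : a ≤ i → i ≤ b → c ≤ j → j ≤ d → Mirrored i j →
                            vtx Q j ≡ reflV axis (vtx Q (suc i))
  mirrored⇒mirrored-start {i} {j} a≤i i≤b c≤j j≤d (eq , same) =
    reflV-reverses-stitch {P = P} {m = axis} odd-axis (steps Q i i<len) (steps Q j j<len) eq (directions same)
    where
    i<len : i < len Q
    i<len = ℕₚ.≤-<-trans i≤b b<len
    j<len : j < len Q
    j<len = ℕₚ.≤-<-trans j≤d d<len
    directions : SameKind i j → (HorizontalAt i × HorizontalAt j) ⊎
                 (IsNorth (vtx Q i) (vtx Q (suc i)) × IsSouth (vtx Q j) (vtx Q (suc j)))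
    directions (inj₁ hh)       = inj₁ hh
    directions (inj₂ (vi , vj)) = inj₂ (north i a≤i i≤b vi , south j c≤j j≤d vj)

  mirrored-step : a ≤ i → i < b → c ≤ j → suc j ≤ d → Mirrored i (suc j) → Mirrored (suc i) j
  mirrored-step a≤i i<b c≤j j<d mirrored =
    mirrored⇒mirrored-start a≤i (ℕₚ.<⇒≤ i<b) (ℕₚ.m≤n⇒m≤1+n c≤j) j<d mirrored ,
    sameKind-step (ℕₚ.≤-<-trans i<b b<len) (ℕₚ.≤-<-trans j<d d<len) (proj₂ mirrored)

  Y-rises-at : a ≤ k → k ≤ b → Y k ℤ.≤ Y (suc k)
  Y-rises-at {k} a≤k k≤b with kind (ℕₚ.≤-<-trans k≤b b<len)
  ... | inj₁ h = ℤₚ.≤-reflexive (sym (horizontal⇒same-row h))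
  ... | inj₂ v = ℤₚ.≤-trans (ℤₚ.i≤i+j (Y k) 1ℤ)
                   (ℤₚ.≤-reflexive (sym (proj₂ (north k a≤k k≤b v))))

  Y-falls-at : c ≤ k → k ≤ d → Y (suc k) ℤ.≤ Y k
  Y-falls-at {k} c≤k k≤d with kind (ℕₚ.≤-<-trans k≤d d<len)
  ... | inj₁ h = ℤₚ.≤-reflexive (horizontal⇒same-row h)
  ... | inj₂ v = ℤₚ.≤-trans (ℤₚ.i≤i+j (Y (suc k)) 1ℤ)
                   (ℤₚ.≤-reflexive (sym (proj₂ (south k c≤k k≤d v))))

  Y-rises : a ≤ i → i ≤ j → j ≤ suc b → Y i ℤ.≤ Y j
  Y-rises a≤i i≤j j≤b+1 = stepwise⇒related {_∼_ = ℤ._≤_} ℤₚ.≤-refl ℤₚ.≤-trans Y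
    (λ i≤k k<j → Y-rises-at (ℕₚ.≤-trans a≤i i≤k) (ℕₚ.≤-pred (ℕₚ.≤-trans k<j j≤b+1))) i≤j

  Y-falls : c ≤ i → i ≤ j → j ≤ suc d → Y j ℤ.≤ Y i
  Y-falls c≤i i≤j j≤d+1 =
    stepwise⇒related {_∼_ = flip ℤ._≤_} ℤₚ.≤-refl (λ x≥y y≥z → ℤₚ.≤-trans y≥z x≥y) Y
    (λ i≤k k<j → Y-falls-at (ℕₚ.≤-trans c≤i i≤k) (ℕₚ.≤-pred (ℕₚ.≤-trans k<j j≤d+1))) i≤j

  horizontal-before-b⇒below-b : a ≤ k → k < b → HorizontalAt k → Y k ℤ.< Y b
  horizontal-before-b⇒below-b {k} a≤k k<b h = +1≤⇒< (begin
    Y k + 1ℤ          ≡⟨ cong (_+ 1ℤ) (horizontal⇒same-row h) ⟨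
    Y (suc k) + 1ℤ    ≡⟨ proj₂ (north (suc k) a≤k+1 k<b v) ⟨
    Y (suc (suc k))   ≤⟨ Y-rises (ℕₚ.m≤n⇒m≤1+n a≤k+1) (ℕ.s≤s k<b) ℕₚ.≤-refl ⟩
    Y (suc b)         ≡⟨ horizontal⇒same-row hb ⟩
    Y b               ∎)
    where
    open ℤₚ.≤-Reasoning
    a≤k+1 : a ≤ suc k
    a≤k+1 = ℕₚ.m≤n⇒m≤1+n a≤k
    v : VerticalAt (suc k)
    v = horizontal⇒next-vertical (ℕₚ.≤-<-trans k<b b<len) h

  horizontal-after-c⇒below-c : c < k → k ≤ d → HorizontalAt k → Y k ℤ.< Y c
  horizontal-after-c⇒below-c {suc k} c<k+1 k+1≤d h = +1≤⇒< (begin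
    Y (suc k) + 1ℤ  ≡⟨ proj₂ (south k c≤k (ℕₚ.<⇒≤ k+1≤d) v) ⟨
    Y k             ≤⟨ Y-falls ℕₚ.≤-refl c≤k (ℕₚ.m≤n⇒m≤1+n (ℕₚ.<⇒≤ k+1≤d)) ⟩
    Y c             ∎)
    where
    open ℤₚ.≤-Reasoning
    c≤k : c ≤ k
    c≤k = ℕₚ.≤-pred c<k+1
    v : VerticalAt k
    v = next-horizontal⇒vertical (ℕₚ.≤-<-trans k+1≤d d<len) h

  ¬mirrored-c-before-b : a ≤ i → i < b → ¬ Mirrored i c
  ¬mirrored-c-before-b a≤i i<b (_ , inj₂ (_ , vc)) = horizontal⇒¬vertical hc vc
  ¬mirrored-c-before-b {i} a≤i i<b (eq , inj₁ (hi , _)) =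
    ℤₚ.<-irrefl Yi≡Yb (horizontal-before-b⇒below-b a≤i i<b hi)
    where
    Yi≡Yb : Y i ≡ Y b
    Yi≡Yb = trans (sym (cong yc eq)) (trans (horizontal⇒same-row hc) (sym Yb≡Yc))

  ¬mirrored-b-before-c : c < j → j ≤ d → ¬ Mirrored b j
  ¬mirrored-b-before-c c<j j≤d (_ , inj₂ (vb , _)) = horizontal⇒¬vertical hb vb
  ¬mirrored-b-before-c {j} c<j j≤d (eq , inj₁ (_ , hj)) =
    ℤₚ.<-irrefl Yj≡Yc (horizontal-after-c⇒below-c c<j j≤d hj)
    where
    Yj≡Yc : Y j ≡ Y c
    Yj≡Yc = trans (sym (horizontal⇒same-row hj)) (trans (cong yc eq) Yb≡Yc)

  Partner : ℕ → Set
  Partner i = ∃ λ j → i ℕ.+ j ≡ a ℕ.+ d × c ≤ j × j ≤ d × Mirrored i j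

  partner : a ≤ i → i ≤ b → Partner i
  partner = ≤-interval-induction Partner (d , refl , c≤d , ℕₚ.≤-refl , mirrored-ends) step
    where
    step : ∀ {i} → a ≤ i → i < b → Partner i → Partner (suc i)
    step a≤i i<b (j , i+j≡a+d , c≤j , j≤d , mirrored) with ℕₚ.m≤n⇒m<n∨m≡n c≤j
    ... | inj₂ refl = ⊥-elim (¬mirrored-c-before-b a≤i i<b mirrored)
    ... | inj₁ (ℕ.s≤s {n = j′} c≤j′) =
      j′ , trans (sym (ℕₚ.+-suc _ j′)) i+j≡a+d , c≤j′ , ℕₚ.<⇒≤ j≤d ,
      mirrored-step a≤i i<b c≤j′ j≤d mirrored

  b+c≡a+d : b ℕ.+ c ≡ a ℕ.+ d
  b+c≡a+d with partner a≤b ℕₚ.≤-refl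
  ... | j , b+j≡a+d , c≤j , j≤d , mirrored with ℕₚ.m≤n⇒m<n∨m≡n c≤j
  ...   | inj₂ refl = b+j≡a+d
  ...   | inj₁ c<j  = ⊥-elim (¬mirrored-b-before-c c<j j≤d mirrored)

  reflected : ReflectedSubpath (reflV axis) Q a b c d
  reflected = from-second , from-first
    where
    from-first : ∀ i → a ≤ i → i ≤ b → ∃ λ j → c ≤ j × j ≤ d ×
                 SameSeg (vtx Q j) (vtx Q (suc j)) (reflV axis (vtx Q i)) (reflV axis (vtx Q (suc i)))
    from-first i a≤i i≤b with partner a≤i i≤b
    ... | j , _ , c≤j , j≤d , mirrored =
      j , c≤j , j≤d , inj₂ (mirrored⇒mirrored-start a≤i i≤b c≤j j≤d mirrored , proj₁ mirrored)

    from-second : ∀ j → c ≤ j → j ≤ d → ∃ λ i → a ≤ i × i ≤ b ×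
                  SameSeg (vtx Q j) (vtx Q (suc j)) (reflV axis (vtx Q i)) (reflV axis (vtx Q (suc i)))
    from-second j c≤j j≤d with mirror-index b+c≡a+d c≤j j≤d
    ... | i , a≤i , i≤b , i+j≡a+d with partner a≤i i≤b
    ...   | j′ , i+j′≡a+d , _ , _ , mirrored
            with ℕₚ.+-cancelˡ-≡ i j′ j (trans i+j′≡a+d (sym i+j≡a+d))
    ...     | refl =
      i , a≤i , i≤b , inj₂ (mirrored⇒mirrored-start a≤i i≤b c≤j j≤d mirrored , proj₁ mirrored)

horizontal-case :
  (Q : HPath P) (a b c d : ℕ) → a ≤ b → b ≤ c → c ≤ d → d < len Q →
  (Horizontal (vtx Q a) (vtx Q (suc a)) × Horizontal (vtx Q b) (vtx Q (suc b)) ×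
   Horizontal (vtx Q c) (vtx Q (suc c)) × Horizontal (vtx Q d) (vtx Q (suc d))) →
  lat2 (vtx Q a) (vtx Q (suc a)) ≡ lat2 (vtx Q d) (vtx Q (suc d)) →
  lat2 (vtx Q b) (vtx Q (suc b)) ≡ lat2 (vtx Q c) (vtx Q (suc c)) →
  (∀ k → a ≤ k → k ≤ b → Vertical (vtx Q k) (vtx Q (suc k)) → IsNorth (vtx Q k) (vtx Q (suc k))) →
  (∀ k → c ≤ k → k ≤ d → Vertical (vtx Q k) (vtx Q (suc k)) → IsSouth (vtx Q k) (vtx Q (suc k))) →
  ∃ λ m → ReflectedSubpath (reflV m) Q a b c d
horizontal-case Q a b c d a≤b b≤c c≤d d<len (ha , hb , hc , hd) lat-ad lat-bc north south =
  axis , reflected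
  where
  open MirrorAcrossVerticalLine Q a≤b b≤c c≤d d<len ha hb hc hd
    (same-latitude⇒same-row ha hd lat-ad) (same-latitude⇒same-row hb hc lat-bc) north south

reflected-transpose : ∀ {m} (Q : HPath P) {a b c d} →
                      ReflectedSubpath (reflV m) (transposePath Q) a b c d →
                      ReflectedSubpath (reflH m) Q a b c d
reflected-transpose _ (from-second , from-first) =
  (λ j c≤j j≤d → let i , a≤i , i≤b , same = from-second j c≤j j≤d
                 in i , a≤i , i≤b , sameSeg-transpose same) ,
  (λ i a≤i i≤b → let j , c≤j , j≤d , same = from-first i a≤i i≤b
                 in j , c≤j , j≤d , sameSeg-transpose same)

vertical-case :
  (Q : HPath P) (a b c d : ℕ) → a ≤ b → b ≤ c → c ≤ d → d < len Q →
  (Vertical (vtx Q a) (vtx Q (suc a)) × Vertical (vtx Q b) (vtx Q (suc b)) ×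
   Vertical (vtx Q c) (vtx Q (suc c)) × Vertical (vtx Q d) (vtx Q (suc d))) →
  lon2 (vtx Q a) (vtx Q (suc a)) ≡ lon2 (vtx Q d) (vtx Q (suc d)) →
  lon2 (vtx Q b) (vtx Q (suc b)) ≡ lon2 (vtx Q c) (vtx Q (suc c)) →
  (∀ k → a ≤ k → k ≤ b → Horizontal (vtx Q k) (vtx Q (suc k)) → IsEast (vtx Q k) (vtx Q (suc k))) →
  (∀ k → c ≤ k → k ≤ d → Horizontal (vtx Q k) (vtx Q (suc k)) → IsWest (vtx Q k) (vtx Q (suc k))) →
  ∃ λ m → ReflectedSubpath (reflH m) Q a b c d
vertical-case Q a b c d a≤b b≤c c≤d d<len (va , vb , vc , vd) lon-ad lon-bc east west =
  let m , reflectedᵀ = horizontal-case (transposePath Q) a b c d a≤b b≤c c≤d d<len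
        (vertical⇒horizontalᵀ va , vertical⇒horizontalᵀ vb ,
         vertical⇒horizontalᵀ vc , vertical⇒horizontalᵀ vd)
        lon-ad lon-bc
        (λ k a≤k k≤b v → east⇒northᵀ {p = vtx Q k} (east k a≤k k≤b (verticalᵀ⇒horizontal v)))
        (λ k c≤k k≤d v → east⇒northᵀ {p = vtx Q (suc k)} (west k c≤k k≤d (verticalᵀ⇒horizontal v)))
  in m , reflected-transpose {m = m} Q reflectedᵀ

lemma2p5 : (P : Pattern) (Q : HPath P) (a b c d : ℕ) →
           a ≤ b → b ≤ c → c ≤ d → d < len Q →
           ((Horizontal (vtx Q a) (vtx Q (suc a)) × Horizontal (vtx Q b) (vtx Q (suc b)) ×
             Horizontal (vtx Q c) (vtx Q (suc c)) × Horizontal (vtx Q d) (vtx Q (suc d))) →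
            lat2 (vtx Q a) (vtx Q (suc a)) ≡ lat2 (vtx Q d) (vtx Q (suc d)) →
            lat2 (vtx Q b) (vtx Q (suc b)) ≡ lat2 (vtx Q c) (vtx Q (suc c)) →
            (∀ k → a ≤ k → k ≤ b → Vertical (vtx Q k) (vtx Q (suc k)) → IsNorth (vtx Q k) (vtx Q (suc k))) →
            (∀ k → c ≤ k → k ≤ d → Vertical (vtx Q k) (vtx Q (suc k)) → IsSouth (vtx Q k) (vtx Q (suc k))) →
            ∃ λ (m : ℤ) → ReflectedSubpath (reflV m) Q a b c d)
           ×
           ((Vertical (vtx Q a) (vtx Q (suc a)) × Vertical (vtx Q b) (vtx Q (suc b)) ×
             Vertical (vtx Q c) (vtx Q (suc c)) × Vertical (vtx Q d) (vtx Q (suc d))) →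
            lon2 (vtx Q a) (vtx Q (suc a)) ≡ lon2 (vtx Q d) (vtx Q (suc d)) →
            lon2 (vtx Q b) (vtx Q (suc b)) ≡ lon2 (vtx Q c) (vtx Q (suc c)) →
            (∀ k → a ≤ k → k ≤ b → Horizontal (vtx Q k) (vtx Q (suc k)) → IsEast (vtx Q k) (vtx Q (suc k))) →
            (∀ k → c ≤ k → k ≤ d → Horizontal (vtx Q k) (vtx Q (suc k)) → IsWest (vtx Q k) (vtx Q (suc k))) →
            ∃ λ (m : ℤ) → ReflectedSubpath (reflH m) Q a b c d)
lemma2p5 P Q a b c d a≤b b≤c c≤d d<len =
  horizontal-case Q a b c d a≤b b≤c c≤d d<len , vertical-case Q a b c d a≤b b≤c c≤d d<len
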